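{- For every integer $k\ge1$ there exists a $\mathsf{TOTO}$ sentence $\phi_k$ such that for every permutation $\sigma$, $\sigma\models\phi_k$ if and only if $\mathbf{S}^k(\sigma)$ is an increasing permutation $12\cdots n$ (i.e. $\sigma$ is sortable by $k$ passes through a stack).
   Context: A permutation $\sigma$ of size $n$ is identified with the finite structure whose domain is $A^\sigma=\{(i,\sigma(i)) : 1\le i\le n\}$, equipped with the position order $<_P$ (comparing first coordinates) and the value order $<_V$ (comparing second coordinates). $\mathsf{TOTO}$ is first-order logic (with equality) over the signature of two binary relation symbols $<_P,<_V$ interpreted in this way. The stack sorting operator $\mathbf{S}$ processes the one-line notation of $\sigma$ from left to right using a stack whose contents are always increasing from top to bottom: when an entry is processed, entries are popped from the top of the stack to the output while the top of the stack is smaller than the new entry, and then the new entry is pushed; when the input is exhausted the stack is emptied to the output. $\mathbf{S}(\sigma)$ is the resulting output permutation, and $\mathbf{S}^k$ denotes the $k$-fold iterate. -}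

module Defs where

open import Data.Nat using (ℕ; zero; suc; _<_; _<?_)
open import Data.Fin using (Fin; toℕ) renaming (zero to fzero; suc to fsuc)
open import Data.Fin.Permutation using (Permutation′; _⟨$⟩ʳ_)
open import Data.List using (List; []; _∷_; _++_; map; allFin)
open import Data.Product using (Σ; _×_; _,_)
open import Data.Sum using (_⊎_)
open import Data.Empty using (⊥)
open import Data.Unit using (⊤)
open import Relation.Nullary using (¬_; yes; no)
open import Relation.Binary.PropositionalEquality using (_≡_)

-- A permutation of size n is a bijection Fin n ↔ Fin n (values 0..n-1,
-- i.e. shifted down by one from the paper's 1..n convention).
-- One-line notation: σ(0) σ(1) … σ(n-1), as a list of naturals.
oneLine : ∀ {n} → Permutation′ n → List ℕ
oneLine {n} σ = map (λ i → toℕ (σ ⟨$⟩ʳ i)) (allFin n)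

pushEntry : ℕ → List ℕ → List ℕ × List ℕ
pushEntry x [] = [] , x ∷ []
pushEntry x (t ∷ s) with t <? x
... | yes _ with pushEntry x s
...   | (o , s') = t ∷ o , s'
pushEntry x (t ∷ s) | no _ = [] , x ∷ t ∷ s

stackRun : List ℕ → List ℕ → List ℕ
stackRun stack [] = stack
stackRun stack (x ∷ xs) with pushEntry x stack
... | (o , stack') = o ++ stackRun stack' xs

S : List ℕ → List ℕ
S xs = stackRun [] xs

iter : {A : Set} → ℕ → (A → A) → A → A
iter zero    f x = x
iter (suc k) f x = f (iter k f x)

identityLine : ℕ → List ℕ
identityLine n = map toℕ (allFin n)

-- TOTO: first-order logic with equality over signature {<P, <V}
-- Formulas with m free variables (de Bruijn indices Fin m).

data Formula : ℕ → Set where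
  _≐_  : ∀ {m} → Fin m → Fin m → Formula m
  _<P_ : ∀ {m} → Fin m → Fin m → Formula m
  _<V_ : ∀ {m} → Fin m → Fin m → Formula m
  ⊤'   : ∀ {m} → Formula m
  ⊥'   : ∀ {m} → Formula m
  ¬'_  : ∀ {m} → Formula m → Formula m
  _∧'_ : ∀ {m} → Formula m → Formula m → Formula m
  _∨'_ : ∀ {m} → Formula m → Formula m → Formula m
  _⇒'_ : ∀ {m} → Formula m → Formula m → Formula m
  ∀'_  : ∀ {m} → Formula (suc m) → Formula m
  ∃'_  : ∀ {m} → Formula (suc m) → Formula m

Sentence : Set
Sentence = Formula 0

extend : ∀ {m} {D : Set} → D → (Fin m → D) → Fin (suc m) → D
extend d ρ fzero    = d
extend d ρ (fsuc i) = ρ i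

-- The element (i, σ(i)) of A^σ is
-- represented by its position i : Fin n (a bijective relabelling of A^σ);
-- (i,σ i) <_P (j,σ j) iff i < j,  (i,σ i) <_V (j,σ j) iff σ i < σ j.
Sat : ∀ {n m} → Permutation′ n → (Fin m → Fin n) → Formula m → Set
Sat σ ρ (x ≐ y)  = ρ x ≡ ρ y
Sat σ ρ (x <P y) = toℕ (ρ x) < toℕ (ρ y)
Sat σ ρ (x <V y) = toℕ (σ ⟨$⟩ʳ ρ x) < toℕ (σ ⟨$⟩ʳ ρ y)
Sat σ ρ ⊤'       = ⊤
Sat σ ρ ⊥'       = ⊥
Sat σ ρ (¬' φ)   = ¬ Sat σ ρ φ
Sat σ ρ (φ ∧' ψ) = Sat σ ρ φ × Sat σ ρ ψ
Sat σ ρ (φ ∨' ψ) = Sat σ ρ φ ⊎ Sat σ ρ ψ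
Sat σ ρ (φ ⇒' ψ) = Sat σ ρ φ → Sat σ ρ ψ
Sat {n} σ ρ (∀' φ) = (d : Fin n) → Sat σ (extend d ρ) φ
Sat {n} σ ρ (∃' φ) = Σ (Fin n) (λ d → Sat σ (extend d ρ) φ)

_⊨_ : ∀ {n} → Permutation′ n → Sentence → Set
σ ⊨ φ = Sat σ (λ ()) φ

-- For a < b, the entry b precedes a in S(π) exactly when π contains b … c … a with b < c:
-- b waits on the stack until a larger entry pushes it out, and a can overtake it only if
-- no such entry arrives first.  So "x precedes y in Sᵏ(σ)" is TOTO-definable by recursion
-- on k, starting from the position order, and Sᵏ(σ) is the identity exactly when this
-- precedence agrees with the value order.

module Submission where

open import Defs
open import Data.Nat using (ℕ; zero; suc; _≤_; _<_; _<?_)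
open import Data.Nat.Properties using (≮⇒≥; <⇒≱; <⇒≢; <-irrefl; <-asym; <-trans; ≤-trans; <-cmp)
open import Data.Fin using (Fin; toℕ) renaming (zero to fzero; suc to fsuc)
import Data.Fin.Properties as Fin
open import Data.Fin.Permutation using (Permutation′; _⟨$⟩ʳ_; _⟨$⟩ˡ_; inverseˡ; inverseʳ)
open import Data.List using (List; []; _∷_; _++_; map; allFin)
open import Data.List.Properties using (++-identityʳ; ++-assoc)
open import Data.List.Membership.Propositional using (_∈_)
open import Data.List.Membership.Propositional.Properties
  using (∈-map⁻; ∈-map⁺; ∈-allFin; ∈-++⁻; ∈-++⁺ˡ; ∈-++⁺ʳ)
open import Data.List.Relation.Unary.Any using (here; there)
open import Data.List.Relation.Unary.All as All using (All; []; _∷_)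
open import Data.List.Relation.Unary.AllPairs using (AllPairs; []; _∷_)
import Data.List.Relation.Unary.AllPairs.Properties as AllPairs
open import Data.List.Relation.Unary.Unique.Propositional using (Unique)
import Data.List.Relation.Unary.Unique.Propositional.Properties as Unique
open import Data.List.Relation.Binary.Permutation.Propositional
  using (_↭_; ↭-refl; ↭-reflexive; ↭-sym; ↭-trans; ↭⇒↭ₛ; module PermutationReasoning)
open import Data.List.Relation.Binary.Permutation.Propositional.Properties
  using (∈-resp-↭; ++⁺ˡ; shift)
import Data.List.Relation.Binary.Permutation.Setoid.Properties as PermutationSetoid
open import Data.Product using (Σ; ∃-syntax; _×_; _,_)
open import Data.Sum using (_⊎_; inj₁; inj₂)
open import Data.Empty using (⊥-elim)
open import Function using (_∘_)
open import Function.Bundles using (_⇔_; mk⇔; Equivalence)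
open import Function.Construct.Composition using (_⇔-∘_)
open import Function.Definitions using (Injective)
open import Relation.Nullary using (¬_; yes; no)
open import Relation.Binary.Definitions using (Asymmetric; tri<; tri≈; tri>)
open import Relation.Binary.PropositionalEquality
  using (_≡_; _≢_; refl; sym; cong; subst; setoid; module ≡-Reasoning)

open Equivalence using (to; from)

data Precedes {A : Set} : List A → A → A → Set where
  first : ∀ {x xs b} → b ∈ xs → Precedes (x ∷ xs) x b
  later : ∀ {x xs a b} → Precedes xs a b → Precedes (x ∷ xs) a b

module _ {A : Set} where

  precedes-∈ˡ : ∀ {xs : List A} {a b} → Precedes xs a b → a ∈ xs
  precedes-∈ˡ (first _) = here refl
  precedes-∈ˡ (later p) = there (precedes-∈ˡ p)

  precedes-∈ʳ : ∀ {xs : List A} {a b} → Precedes xs a b → b ∈ xs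
  precedes-∈ʳ (first b∈xs) = there b∈xs
  precedes-∈ʳ (later p)    = there (precedes-∈ʳ p)

  precedes-∈-tail : ∀ {x : A} {xs a b} → Precedes (x ∷ xs) a b → b ∈ xs
  precedes-∈-tail (first b∈xs) = b∈xs
  precedes-∈-tail (later p)    = precedes-∈ʳ p

  precedes-++⁺ˡ : ∀ {xs ys : List A} {a b} → Precedes xs a b → Precedes (xs ++ ys) a b
  precedes-++⁺ˡ (first b∈xs) = first (∈-++⁺ˡ b∈xs)
  precedes-++⁺ˡ (later p)    = later (precedes-++⁺ˡ p)

  precedes-++⁺ʳ : ∀ xs {ys : List A} {a b} → Precedes ys a b → Precedes (xs ++ ys) a b
  precedes-++⁺ʳ []       p = p
  precedes-++⁺ʳ (_ ∷ xs) p = later (precedes-++⁺ʳ xs p)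

  precedes-++⁺ : ∀ {xs ys : List A} {a b} → a ∈ xs → b ∈ ys → Precedes (xs ++ ys) a b
  precedes-++⁺ {_ ∷ xs} (here refl) b∈ys = first (∈-++⁺ʳ xs b∈ys)
  precedes-++⁺ (there a∈xs) b∈ys = later (precedes-++⁺ a∈xs b∈ys)

  precedes-++⁻ : ∀ xs {ys : List A} {a b} → Precedes (xs ++ ys) a b →
                 (a ∈ xs × b ∈ ys) ⊎ Precedes xs a b ⊎ Precedes ys a b
  precedes-++⁻ []       p = inj₂ (inj₂ p)
  precedes-++⁻ (_ ∷ xs) (first b∈) with ∈-++⁻ xs b∈
  ... | inj₁ b∈xs = inj₂ (inj₁ (first b∈xs))
  ... | inj₂ b∈ys = inj₁ (here refl , b∈ys)
  precedes-++⁻ (_ ∷ xs) (later p) with precedes-++⁻ xs p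
  ... | inj₁ (a∈xs , b∈ys) = inj₁ (there a∈xs , b∈ys)
  ... | inj₂ (inj₁ q)      = inj₂ (inj₁ (later q))
  ... | inj₂ (inj₂ q)      = inj₂ (inj₂ q)

  precedes-total : ∀ {xs : List A} {a b} → a ∈ xs → b ∈ xs → a ≢ b →
                   Precedes xs a b ⊎ Precedes xs b a
  precedes-total (here refl)  (here refl)  a≢b = ⊥-elim (a≢b refl)
  precedes-total (here refl)  (there b∈xs) _   = inj₁ (first b∈xs)
  precedes-total (there a∈xs) (here refl)  _   = inj₂ (first a∈xs)
  precedes-total (there a∈xs) (there b∈xs) a≢b with precedes-total a∈xs b∈xs a≢b
  ... | inj₁ p = inj₁ (later p)
  ... | inj₂ p = inj₂ (later p)

  precedes-asym : ∀ {xs : List A} {a b} → Unique xs → Precedes xs a b → ¬ Precedes xs b a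
  precedes-asym (x∉xs ∷ _) (first b∈xs) (first _) = All.lookup x∉xs b∈xs refl
  precedes-asym (x∉xs ∷ _) (first _)    (later q) = All.lookup x∉xs (precedes-∈ʳ q) refl
  precedes-asym (x∉xs ∷ _) (later p)    (first _) = All.lookup x∉xs (precedes-∈ʳ p) refl
  precedes-asym (_ ∷ xs!)  (later p)    (later q) = precedes-asym xs! p q

  module _ {R : A → A → Set} where

    lookup-precedes : ∀ {xs a b} → AllPairs R xs → Precedes xs a b → R a b
    lookup-precedes (Rx ∷ _)  (first b∈xs) = All.lookup Rx b∈xs
    lookup-precedes (_ ∷ Rxs) (later p)    = lookup-precedes Rxs p

    precedes⇒AllPairs : ∀ xs → (∀ {a b} → Precedes xs a b → R a b) → AllPairs R xs
    precedes⇒AllPairs []       _ = []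
    precedes⇒AllPairs (_ ∷ xs) R-precedes =
      All.tabulate (R-precedes ∘ first) ∷ precedes⇒AllPairs xs (R-precedes ∘ later)

    sorted⇒precedes : ∀ {xs a b} → Asymmetric R → AllPairs R xs →
                      a ∈ xs → b ∈ xs → R a b → Precedes xs a b
    sorted⇒precedes asym Rxs a∈xs b∈xs Rab with precedes-total a∈xs b∈xs (λ { refl → asym Rab Rab })
    ... | inj₁ p = p
    ... | inj₂ p = ⊥-elim (asym Rab (lookup-precedes Rxs p))

module _ {A B : Set} {f : A → B} where

  precedes-map⁺ : ∀ {xs a b} → Precedes xs a b → Precedes (map f xs) (f a) (f b)
  precedes-map⁺ (first b∈xs) = first (∈-map⁺ f b∈xs)
  precedes-map⁺ (later p)    = later (precedes-map⁺ p)

  precedes-map⁻ : Injective _≡_ _≡_ f → ∀ {xs a b} →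
                  Precedes (map f xs) (f a) (f b) → Precedes xs a b
  precedes-map⁻ f-inj = go refl refl
    where
    go : ∀ {xs a b a′ b′} → f a ≡ a′ → f b ≡ b′ → Precedes (map f xs) a′ b′ → Precedes xs a b
    go {_ ∷ _} fa≡ fb≡ (first fb∈) with f-inj fa≡ | ∈-map⁻ f fb∈
    ... | refl | _ , b′∈xs , refl with f-inj fb≡
    ...   | refl = first b′∈xs
    go {_ ∷ _} fa≡ fb≡ (later p) = later (go fa≡ fb≡ p)

  precedes-map : Injective _≡_ _≡_ f → ∀ {xs a b} →
                 Precedes xs a b ⇔ Precedes (map f xs) (f a) (f b)
  precedes-map f-inj = mk⇔ precedes-map⁺ (precedes-map⁻ f-inj)

strictlySorted-≡ : ∀ {xs ys : List ℕ} → AllPairs _<_ xs → AllPairs _<_ ys →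
                   (∀ {z} → z ∈ xs → z ∈ ys) → (∀ {z} → z ∈ ys → z ∈ xs) → xs ≡ ys
strictlySorted-≡ {[]}    {[]}    _ _ _ _ = refl
strictlySorted-≡ {[]}    {_ ∷ _} _ _ _ ys⊆xs with ys⊆xs (here refl)
... | ()
strictlySorted-≡ {_ ∷ _} {[]}    _ _ xs⊆ys _ with xs⊆ys (here refl)
... | ()
strictlySorted-≡ {x ∷ xs} {y ∷ ys} (x< ∷ xs↑) (y< ∷ ys↑) xs⊆ys ys⊆xs
  with heads-≡ (xs⊆ys (here refl)) (ys⊆xs (here refl))
  where
  heads-≡ : x ∈ y ∷ ys → y ∈ x ∷ xs → x ≡ y
  heads-≡ (here x≡y)   _            = x≡y
  heads-≡ (there _)    (here y≡x)   = sym y≡x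
  heads-≡ (there x∈ys) (there y∈xs) = ⊥-elim (<-asym (All.lookup x< y∈xs) (All.lookup y< x∈ys))
... | refl = cong (x ∷_) (strictlySorted-≡ xs↑ ys↑
  (λ z∈xs → drop-head (All.lookup x< z∈xs) (xs⊆ys (there z∈xs)))
  (λ z∈ys → drop-head (All.lookup y< z∈ys) (ys⊆xs (there z∈ys))))
  where
  drop-head : ∀ {z} {ws : List ℕ} → x < z → z ∈ x ∷ ws → z ∈ ws
  drop-head x<z (here refl)  = ⊥-elim (<-irrefl refl x<z)
  drop-head _   (there z∈ws) = z∈ws

SmallerFirst : List ℕ → Set
SmallerFirst xs = ∀ {a b} → a ∈ xs → b ∈ xs → a < b → Precedes xs a b

smallerFirst⇔strictlySorted : ∀ {xs} → Unique xs → SmallerFirst xs ⇔ AllPairs _<_ xs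
smallerFirst⇔strictlySorted {xs} xs! = mk⇔ (precedes⇒AllPairs xs ∘ precedes⇒<)
                                          (λ xs↑ → sorted⇒precedes <-asym xs↑)
  where
  precedes⇒< : SmallerFirst xs → ∀ {a b} → Precedes xs a b → a < b
  precedes⇒< inOrder {a} {b} a≺b with <-cmp a b
  ... | tri< a<b _ _  = a<b
  ... | tri≈ _ refl _ = ⊥-elim (precedes-asym xs! a≺b a≺b)
  ... | tri> _ _ b<a  = ⊥-elim (precedes-asym xs! a≺b (inOrder (precedes-∈ʳ a≺b) (precedes-∈ˡ a≺b) b<a))

data PushView (x : ℕ) : List ℕ → List ℕ × List ℕ → Set where
  pops : ∀ popped rest → All (_< x) popped → All (x ≤_) rest →
         PushView x (popped ++ rest) (popped , x ∷ rest)

pushEntry-view : ∀ x stack → AllPairs _≤_ stack → PushView x stack (pushEntry x stack)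
pushEntry-view x []      _ = pops [] [] [] []
pushEntry-view x (t ∷ s) (t≤s ∷ s↑) with t <? x
... | yes t<x with pushEntry x s | pushEntry-view x s s↑
...   | .(o , x ∷ rest) | pops o rest o<x x≤rest = pops (t ∷ o) rest (t<x ∷ o<x) x≤rest
pushEntry-view x (t ∷ s) (t≤s ∷ _) | no t≮x =
  pops [] (t ∷ s) [] (x≤t ∷ All.map (≤-trans x≤t) t≤s)
  where
  x≤t : x ≤ t
  x≤t = ≮⇒≥ t≮x

push-sorted : ∀ {x} popped rest → All (x ≤_) rest →
              AllPairs _≤_ (popped ++ rest) → AllPairs _≤_ (x ∷ rest)
push-sorted []      rest x≤rest rest↑         = x≤rest ∷ rest↑
push-sorted (_ ∷ o) rest x≤rest (_ ∷ o++rest↑) = push-sorted o rest x≤rest o++rest↑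

stackRun-↭ : ∀ stack xs → AllPairs _≤_ stack → stackRun stack xs ↭ stack ++ xs
stackRun-↭ stack []       _ = ↭-reflexive (sym (++-identityʳ stack))
stackRun-↭ stack (x ∷ xs) stack↑ with pushEntry x stack | pushEntry-view x stack stack↑
... | .(o , x ∷ rest) | pops o rest _ x≤rest = begin
  o ++ stackRun (x ∷ rest) xs ↭⟨ ++⁺ˡ o (stackRun-↭ (x ∷ rest) xs (push-sorted o rest x≤rest stack↑)) ⟩
  o ++ x ∷ rest ++ xs         ↭⟨ shift x o (rest ++ xs) ⟩
  x ∷ o ++ rest ++ xs         ≡⟨ cong (x ∷_) (++-assoc o rest xs) ⟨
  x ∷ (o ++ rest) ++ xs       ↭⟨ shift x (o ++ rest) xs ⟨
  (o ++ rest) ++ x ∷ xs       ∎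
  where open PermutationReasoning

S-↭ : ∀ xs → S xs ↭ xs
S-↭ xs = stackRun-↭ [] xs []

Pattern231 : List ℕ → ℕ → ℕ → Set
Pattern231 xs b a = ∃[ c ] Precedes xs b c × Precedes xs c a × b < c

-- A run started from a nonempty stack: b, if still on the stack, is popped by the first later
-- entry exceeding it.
PoppedBefore : List ℕ → List ℕ → ℕ → ℕ → Set
PoppedBefore stack xs b a = (b ∈ stack × ∃[ c ] Precedes xs c a × b < c) ⊎ Pattern231 xs b a

stackRun-inversion⁻ : ∀ stack xs {a b} → AllPairs _≤_ stack → a < b →
                      Precedes (stackRun stack xs) b a → PoppedBefore stack xs b a
stackRun-inversion⁻ stack [] stack↑ a<b b≺a = ⊥-elim (<⇒≱ a<b (lookup-precedes stack↑ b≺a))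
stackRun-inversion⁻ stack (x ∷ xs) stack↑ a<b b≺a
  with pushEntry x stack | pushEntry-view x stack stack↑
... | .(o , x ∷ rest) | pops o rest o<x x≤rest
  with precedes-++⁻ o b≺a
...   | inj₂ (inj₁ b≺a-in-o) = ⊥-elim (<⇒≱ a<b (lookup-precedes stack↑ (precedes-++⁺ˡ b≺a-in-o)))
...   | inj₁ (b∈o , a∈later)
  -- b is popped by x, and a < b < x rules out a = x and a still on the stack.
  with ∈-++⁻ (x ∷ rest) (∈-resp-↭ (stackRun-↭ (x ∷ rest) xs (push-sorted o rest x≤rest stack↑)) a∈later)
...     | inj₁ (here refl)    = ⊥-elim (<-asym a<b (All.lookup o<x b∈o))
...     | inj₁ (there a∈rest) = ⊥-elim (<⇒≱ (<-trans a<b (All.lookup o<x b∈o)) (All.lookup x≤rest a∈rest))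
...     | inj₂ a∈xs           = inj₁ (∈-++⁺ˡ b∈o , x , first a∈xs , All.lookup o<x b∈o)
stackRun-inversion⁻ stack (x ∷ xs) stack↑ a<b b≺a | .(o , x ∷ rest) | pops o rest o<x x≤rest
      | inj₂ (inj₂ b≺a-later)
  with stackRun-inversion⁻ (x ∷ rest) xs (push-sorted o rest x≤rest stack↑) a<b b≺a-later
... | inj₁ (here refl , c , c≺a , b<c)    = inj₂ (c , first (precedes-∈ˡ c≺a) , later c≺a , b<c)
... | inj₁ (there b∈rest , c , c≺a , b<c) = inj₁ (∈-++⁺ʳ o b∈rest , c , later c≺a , b<c)
... | inj₂ (c , b≺c , c≺a , b<c)          = inj₂ (c , later b≺c , later c≺a , b<c)

stackRun-inversion⁺ : ∀ stack xs {a b} → AllPairs _≤_ stack → Unique xs → a < b →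
                      PoppedBefore stack xs b a → Precedes (stackRun stack xs) b a
stackRun-inversion⁺ stack [] _ _ _ (inj₁ (_ , _ , () , _))
stackRun-inversion⁺ stack [] _ _ _ (inj₂ (_ , () , _))
stackRun-inversion⁺ stack (x ∷ xs) {a} {b} stack↑ (x∉xs ∷ xs!) a<b popped
  with pushEntry x stack | pushEntry-view x stack stack↑
... | .(o , x ∷ rest) | pops o rest o<x x≤rest = go popped
  where
  pushed↑ : AllPairs _≤_ (x ∷ rest)
  pushed↑ = push-sorted o rest x≤rest stack↑

  IH : PoppedBefore (x ∷ rest) xs b a → Precedes (stackRun (x ∷ rest) xs) b a
  IH = stackRun-inversion⁺ (x ∷ rest) xs pushed↑ xs! a<b

  go : PoppedBefore (o ++ rest) (x ∷ xs) b a → Precedes (o ++ stackRun (x ∷ rest) xs) b a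
  go (inj₁ (b∈stack , c , c≺a , b<c)) with ∈-++⁻ o b∈stack
  ... | inj₁ b∈o = precedes-++⁺ b∈o
        (∈-resp-↭ (↭-sym (stackRun-↭ (x ∷ rest) xs pushed↑)) (there (∈-++⁺ʳ rest (precedes-∈-tail c≺a))))
  ... | inj₂ b∈rest with c≺a
  ...   | first _    = ⊥-elim (<⇒≱ b<c (All.lookup x≤rest b∈rest))
  ...   | later c≺a′ = precedes-++⁺ʳ o (IH (inj₁ (there b∈rest , c , c≺a′ , b<c)))
  go (inj₂ (c , first _   , first _   , b<c)) = ⊥-elim (<-irrefl refl b<c)
  go (inj₂ (c , first _   , later c≺a , b<c)) = precedes-++⁺ʳ o (IH (inj₁ (here refl , c , c≺a , b<c)))
  go (inj₂ (c , later b≺c , first _   , b<c)) = ⊥-elim (All.lookup x∉xs (precedes-∈ʳ b≺c) refl)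
  go (inj₂ (c , later b≺c , later c≺a , b<c)) = precedes-++⁺ʳ o (IH (inj₂ (c , b≺c , c≺a , b<c)))

S-inversion : ∀ xs {a b} → Unique xs → a < b → Precedes (S xs) b a ⇔ Pattern231 xs b a
S-inversion xs xs! a<b = mk⇔ (empty-stack ∘ stackRun-inversion⁻ [] xs [] a<b)
                             (stackRun-inversion⁺ [] xs [] xs! a<b ∘ inj₂)
  where
  empty-stack : ∀ {a b} → PoppedBefore [] xs b a → Pattern231 xs b a
  empty-stack (inj₁ (() , _))
  empty-stack (inj₂ p) = p

allFin-sorted : ∀ n → AllPairs (λ i j → toℕ i < toℕ j) (allFin n)
allFin-sorted n = AllPairs.tabulate⁺-< (λ i<j → i<j)

allFin-precedes : ∀ {n} (i j : Fin n) → toℕ i < toℕ j ⇔ Precedes (allFin n) i j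
allFin-precedes {n} i j = mk⇔ (sorted⇒precedes Fin.<-asym (allFin-sorted n) (∈-allFin i) (∈-allFin j))
                              (lookup-precedes (allFin-sorted n))

identityLine-sorted : ∀ n → AllPairs _<_ (identityLine n)
identityLine-sorted n = AllPairs.map⁺ (allFin-sorted n)

mutual
  precedesᶠ : ℕ → ∀ {m} → Fin m → Fin m → Formula m
  precedesᶠ zero    x y = x <P y
  precedesᶠ (suc k) x y = ((y <V x) ∧' pattern231ᶠ k x y) ∨' ((x <V y) ∧' (¬' pattern231ᶠ k y x))

  pattern231ᶠ : ℕ → ∀ {m} → Fin m → Fin m → Formula m
  pattern231ᶠ k b a = ∃' (precedesᶠ k (fsuc b) fzero ∧' (precedesᶠ k fzero (fsuc a) ∧' (fsuc b <V fzero)))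

sortable : ℕ → Sentence
sortable k = ∀' ∀' ((fsuc fzero <V fzero) ⇒' precedesᶠ k (fsuc fzero) fzero)

module _ {n} (σ : Permutation′ n) where

  value : Fin n → ℕ
  value i = toℕ (σ ⟨$⟩ʳ i)

  value-injective : Injective _≡_ _≡_ value
  value-injective {i} {j} vi≡vj = begin
    i                          ≡⟨ inverseˡ σ ⟨
    σ ⟨$⟩ˡ (σ ⟨$⟩ʳ i)          ≡⟨ cong (σ ⟨$⟩ˡ_) (Fin.toℕ-injective vi≡vj) ⟩
    σ ⟨$⟩ˡ (σ ⟨$⟩ʳ j)          ≡⟨ inverseˡ σ ⟩
    j                          ∎
    where open ≡-Reasoning

  line : ℕ → List ℕ
  line k = iter k S (oneLine σ)

  line-↭ : ∀ k → line k ↭ oneLine σ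
  line-↭ zero    = ↭-refl
  line-↭ (suc k) = ↭-trans (S-↭ (line k)) (line-↭ k)

  line-unique : ∀ k → Unique (line k)
  line-unique k = PermutationSetoid.Unique-resp-↭ (setoid ℕ) (↭⇒↭ₛ (↭-sym (line-↭ k)))
                    (Unique.map⁺ value-injective (Unique.allFin⁺ n))

  ∈-line⁻ : ∀ k {z} → z ∈ line k → ∃[ d ] value d ≡ z
  ∈-line⁻ k z∈ with ∈-map⁻ value (∈-resp-↭ (line-↭ k) z∈)
  ... | d , _ , z≡vd = d , sym z≡vd

  ∈-line⁺ : ∀ k d → value d ∈ line k
  ∈-line⁺ k d = ∈-resp-↭ (↭-sym (line-↭ k)) (∈-map⁺ value (∈-allFin d))

  mutual
    Sat-precedesᶠ : ∀ k {m} (ρ : Fin m → Fin n) x y →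
                   Sat σ ρ (precedesᶠ k x y) ⇔ Precedes (line k) (value (ρ x)) (value (ρ y))
    Sat-precedesᶠ zero    ρ x y = precedes-map value-injective ⇔-∘ allFin-precedes (ρ x) (ρ y)
    Sat-precedesᶠ (suc k) ρ x y = mk⇔ sound complete
      where
      line-k! : Unique (line k)
      line-k! = line-unique k

      vx vy : ℕ
      vx = value (ρ x)
      vy = value (ρ y)

      sound : Sat σ ρ (precedesᶠ (suc k) x y) → Precedes (line (suc k)) vx vy
      sound (inj₁ (vy<vx , x≺z≺y)) =
        from (S-inversion (line k) line-k! vy<vx) (to (Sat-pattern231ᶠ k ρ x y) x≺z≺y)
      sound (inj₂ (vx<vy , no-231))
        with precedes-total (∈-line⁺ (suc k) (ρ x)) (∈-line⁺ (suc k) (ρ y)) (<⇒≢ vx<vy)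
      ... | inj₁ x≺y = x≺y
      ... | inj₂ y≺x =
        ⊥-elim (no-231 (from (Sat-pattern231ᶠ k ρ y x) (to (S-inversion (line k) line-k! vx<vy) y≺x)))

      complete : Precedes (line (suc k)) vx vy → Sat σ ρ (precedesᶠ (suc k) x y)
      complete x≺y with <-cmp vx vy
      ... | tri< vx<vy _ _ = inj₂ (vx<vy , λ y≺z≺x →
              precedes-asym (line-unique (suc k)) x≺y
                (from (S-inversion (line k) line-k! vx<vy) (to (Sat-pattern231ᶠ k ρ y x) y≺z≺x)))
      ... | tri≈ _ vx≡vy _ = ⊥-elim (precedes-asym (line-unique (suc k)) y≺y y≺y)
        where
        y≺y : Precedes (line (suc k)) vy vy
        y≺y = subst (λ z → Precedes (line (suc k)) z vy) vx≡vy x≺y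
      ... | tri> _ _ vy<vx =
        inj₁ (vy<vx , from (Sat-pattern231ᶠ k ρ x y) (to (S-inversion (line k) line-k! vy<vx) x≺y))

    Sat-pattern231ᶠ : ∀ k {m} (ρ : Fin m → Fin n) b a →
                   Sat σ ρ (pattern231ᶠ k b a) ⇔ Pattern231 (line k) (value (ρ b)) (value (ρ a))
    Sat-pattern231ᶠ k ρ b a = mk⇔ sound complete
      where
      sound : Sat σ ρ (pattern231ᶠ k b a) → Pattern231 (line k) (value (ρ b)) (value (ρ a))
      sound (d , b≺d , d≺a , b<d) =
        value d , to (Sat-precedesᶠ k _ (fsuc b) fzero) b≺d , to (Sat-precedesᶠ k _ fzero (fsuc a)) d≺a , b<d

      complete : Pattern231 (line k) (value (ρ b)) (value (ρ a)) → Sat σ ρ (pattern231ᶠ k b a)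
      complete (c , b≺c , c≺a , b<c) with ∈-line⁻ k (precedes-∈ʳ b≺c)
      ... | d , refl =
        d , from (Sat-precedesᶠ k _ (fsuc b) fzero) b≺c , from (Sat-precedesᶠ k _ fzero (fsuc a)) c≺a , b<c

  ⊨-sortable : ∀ k → σ ⊨ sortable k ⇔ SmallerFirst (line k)
  ⊨-sortable k = mk⇔ sound complete
    where
    sound : σ ⊨ sortable k → SmallerFirst (line k)
    sound ⊨sortable a∈ b∈ with ∈-line⁻ k a∈ | ∈-line⁻ k b∈
    ... | d , refl | e , refl = to (Sat-precedesᶠ k _ (fsuc fzero) fzero) ∘ ⊨sortable d e

    complete : SmallerFirst (line k) → σ ⊨ sortable k
    complete inOrder d e = from (Sat-precedesᶠ k _ (fsuc fzero) fzero) ∘ inOrder (∈-line⁺ k d) (∈-line⁺ k e)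

  strictlySorted⇔line≡identity : ∀ k → AllPairs _<_ (line k) ⇔ line k ≡ identityLine n
  strictlySorted⇔line≡identity k = mk⇔
    (λ line↑ → strictlySorted-≡ line↑ (identityLine-sorted n) line⊆id id⊆line)
    (λ line≡id → subst (AllPairs _<_) (sym line≡id) (identityLine-sorted n))
    where
    line⊆id : ∀ {z} → z ∈ line k → z ∈ identityLine n
    line⊆id z∈ with ∈-line⁻ k z∈
    ... | d , refl = ∈-map⁺ toℕ (∈-allFin (σ ⟨$⟩ʳ d))

    id⊆line : ∀ {z} → z ∈ identityLine n → z ∈ line k
    id⊆line z∈ with ∈-map⁻ toℕ z∈
    ... | p , _ , refl = subst (λ q → toℕ q ∈ line k) (inverseʳ σ) (∈-line⁺ k (σ ⟨$⟩ˡ p))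

  sortable-correct : ∀ k → σ ⊨ sortable k ⇔ (iter k S (oneLine σ) ≡ identityLine n)
  sortable-correct k =
    strictlySorted⇔line≡identity k ⇔-∘ (smallerFirst⇔strictlySorted (line-unique k) ⇔-∘ ⊨-sortable k)

corollary3p15 : (k : ℕ) → 1 ≤ k →
    Σ Sentence (λ φ → (n : ℕ) (σ : Permutation′ n) →
      (σ ⊨ φ) ⇔ (iter k S (oneLine σ) ≡ identityLine n))
corollary3p15 k _ = sortable k , λ n σ → sortable-correct σ k
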